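{- Let $q$ be a prime power, $n\ge 2$, and let $G:=AGL_n(q)$ act in its natural (affine) action on $V:=(\mathbb{F}_q)^n$. Let $U_1\le G$ be the stabilizer of a point of $V$, and let $U_2:=V\rtimes H$, where $H\le GL_n(q)$ is the stabilizer of a one-dimensional subspace of $V$. Then $U_1$ and $U_2$ are proper subgroups of $G$ and $G=\bigcup_{x\in G}U_1^x\cup\bigcup_{x\in G}U_2^x$, i.e. $U_1,U_2$ form a $2$-covering of $G$.
   Context: $AGL_n(q)=V\rtimes GL_n(q)$ is the group of affine maps $x\mapsto Ax+v$ of $V=(\mathbb{F}_q)^n$ with $A\in GL_n(q)$, $v\in V$. A finite group $G$ is $k$-coverable if there exist proper subgroups $U_1,\dots,U_k$ such that every element of $G$ lies in a conjugate of one of the $U_i$; such $U_i$ are said to form a $k$-covering. -}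

module Defs where

open import Level using (Level; suc; _⊔_)
open import Data.Nat using (ℕ; zero; _^_)
import Data.Nat as ℕ
open import Data.Nat.Primality using (Prime)
open import Data.Fin using (Fin)
import Data.Fin as Fin
open import Data.Product using (Σ; ∃; _×_; _,_)
open import Data.Sum using (_⊎_)
open import Relation.Binary.PropositionalEquality using (_≡_)
open import Relation.Nullary using (¬_)
open import Algebra.Structures using (IsCommutativeRing)
open import Function.Bundles using (_↔_)

IsPrimePower : ℕ → Set
IsPrimePower q = Σ ℕ λ p → Σ ℕ λ k → Prime p × q ≡ p ^ ℕ.suc k

record Field (c : Level) : Set (suc c) where
  infixl 6 _+_
  infixl 7 _*_
  field
    Carrier : Set c
    _+_ _*_ : Carrier → Carrier → Carrier
    -_      : Carrier → Carrier
    0# 1#   : Carrier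
    isCommutativeRing : IsCommutativeRing _≡_ _+_ _*_ -_ 0# 1#
    0≢1     : ¬ (0# ≡ 1#)
    inverse : ∀ x → ¬ (x ≡ 0#) → ∃ λ y → x * y ≡ 1#

HasOrder : ∀ {c} → Field c → ℕ → Set c
HasOrder F q = Fin q ↔ Field.Carrier F

module Affine {c} (F : Field c) (n : ℕ) where
  open Field F

  Vec : Set c
  Vec = Fin n → Carrier

  Mat : Set c
  Mat = Fin n → Fin n → Carrier

  ∑ : ∀ {m} → (Fin m → Carrier) → Carrier
  ∑ {zero}    f = 0#
  ∑ {ℕ.suc m} f = f Fin.zero + ∑ (λ i → f (Fin.suc i))

  _·_ : Mat → Vec → Vec
  (A · v) i = ∑ λ j → A i j * v j

  _⊗_ : Mat → Mat → Mat
  (A ⊗ B) i k = ∑ λ j → A i j * B j k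

  _⊕_ : Vec → Vec → Vec
  (u ⊕ v) i = u i + v i

  ⊖_ : Vec → Vec
  (⊖ v) i = - (v i)

  𝟎 : Vec
  𝟎 i = 0#

  I : Mat
  I i j with i Fin.≟ j
  ... | Relation.Nullary.yes _ = 1#
  ... | Relation.Nullary.no _  = 0#

  _≈ᵥ_ : Vec → Vec → Set c
  u ≈ᵥ v = ∀ i → u i ≡ v i

  _≈ₘ_ : Mat → Mat → Set c
  A ≈ₘ B = ∀ i j → A i j ≡ B i j

  record GL : Set c where
    constructor mkGL
    field
      mat  : Mat
      inv  : Mat
      linv : (inv ⊗ mat) ≈ₘ I
      rinv : (mat ⊗ inv) ≈ₘ I
  open GL public

  record AGL : Set c where
    constructor aff
    field
      lin   : GL
      trans : Vec
  open AGL public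

  act : AGL → Vec → Vec
  act (aff A v) x = (mat A · x) ⊕ v

  _≈_ : AGL → AGL → Set c
  g ≈ h = (mat (lin g) ≈ₘ mat (lin h)) × (trans g ≈ᵥ trans h)

  -- group law (g ∘ h)(x) = g (h x), stated as a relation: k = g h
  IsProduct : AGL → AGL → AGL → Set c
  IsProduct g h k =
    (mat (lin k) ≈ₘ (mat (lin g) ⊗ mat (lin h)))
    × (trans k ≈ᵥ ((mat (lin g) · trans h) ⊕ trans g))

  IsIdentity : AGL → Set c
  IsIdentity g = (mat (lin g) ≈ₘ I) × (trans g ≈ᵥ 𝟎)

  Subset : Set (suc c)
  Subset = AGL → Set c

  IsSubgroup : Subset → Set c
  IsSubgroup U =
    (∀ g → IsIdentity g → U g)
    × (∀ g h k → U g → U h → IsProduct g h k → U k)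
    × (∀ g h k → U g → IsProduct g h k → IsIdentity k → U h)

  IsProperSubgroup : Subset → Set c
  IsProperSubgroup U = IsSubgroup U × ∃ λ g → ¬ U g

  -- g lies in the conjugate x U x⁻¹, i.e. g = x u x⁻¹ for some u ∈ U (g x = x u)
  InConjugate : Subset → AGL → AGL → Set c
  InConjugate U x g = ∃ λ u → U u × ∃ λ m → IsProduct x u m × IsProduct g x m

  PointStab : Vec → Subset
  PointStab p g = act g p ≈ᵥ p

  InSpan : Vec → Vec → Set c
  InSpan w v = ∃ λ a → ∀ i → v i ≡ a * w i

  -- U₂ = V ⋊ H, H = stabilizer in GL_n(q) of the line ⟨w⟩ (w ≠ 0):
  -- the matrix part A maps ⟨w⟩ into (hence onto) ⟨w⟩, translation arbitrary
  LineStab : Vec → Subset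
  LineStab w g = ∀ v → InSpan w v → InSpan w (mat (lin g) · v)

  Covers₂ : Subset → Subset → Set c
  Covers₂ U₁ U₂ = ∀ g → (∃ λ x → InConjugate U₁ x g) ⊎ (∃ λ x → InConjugate U₂ x g)

module Submission where

open import Defs
open import Level using (Level)
open import Data.Nat using (ℕ; zero; suc; _≤_; s≤s; _^_)
open import Data.Nat.Properties using (1+n≰n)
open import Data.Fin using (Fin; zero; suc; punchIn; punchOut; funToFin; finToFun; combine; fromℕ<; _≟_)
open import Data.Fin.Properties
  using ( any?; all?; ¬∀⟶∃¬; inj⇒≟; injective⇒≤; punchInᵢ≢i; punchOut-injective
        ; finToFun-funToFin; funToFin-finToFin)
open import Data.Product using (∃; _×_; _,_; proj₂)
open import Data.Sum using (inj₁; inj₂)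
open import Data.Vec.Functional.Relation.Binary.Equality.Setoid using (≋-setoid)
open import Function using (_∘_; _↔_; Inverse; Injective; StrictlySurjective)
open import Function.Properties.Inverse using (↔⇒↣; ↔-sym)
open import Relation.Binary.Bundles using (Setoid)
open import Relation.Binary.Definitions using (DecidableEquality)
open import Relation.Binary.PropositionalEquality
  using (_≡_; _≢_; refl; sym; trans; cong; cong₂; _≗_; setoid; module ≡-Reasoning)
open import Relation.Nullary using (¬_; Dec; yes; no; contradiction)
open import Relation.Nullary.Decidable using (map′; ¬?; _×-dec_; decidable-stable)
open import Relation.Unary using (Pred; Decidable)
open import Algebra.Bundles using (CommutativeRing; AbelianGroup)
import Algebra.Construct.Pointwise as Pointwise
import Algebra.Properties.AbelianGroup as AbelianGroupProperties
import Algebra.Properties.CommutativeSemigroup as CommutativeSemigroupProperties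
import Algebra.Properties.Ring as RingProperties
import Algebra.Properties.Semiring.Sum as SumProperties
import Algebra.Solver.Ring.NaturalCoefficients.Default as NaturalSolver
import Relation.Binary.Reasoning.Setoid as SetoidReasoning

-- Write g = (x ↦ A x + v). If A fixes a nonzero vector z, then A stabilises the line ⟨z⟩, and
-- since GL_n(q) is transitive on nonzero vectors (a transvection sends w to z), g is conjugate
-- by a linear map into V ⋊ H. Otherwise x ↦ x − A x is injective, hence surjective because V is
-- finite, so g has a fixed point y, and conjugating by the translation y − p moves g into the
-- stabiliser of p. Both subgroups are proper: a nonzero translation moves p, and for n ≥ 2 a
-- linear map sending w to a unit vector outside ⟨w⟩ does not stabilise ⟨w⟩.

funToFin-cong : ∀ {m k} {f g : Fin m → Fin k} → f ≗ g → funToFin f ≡ funToFin g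
funToFin-cong {zero}  eq = refl
funToFin-cong {suc m} eq = cong₂ combine (eq zero) (funToFin-cong (eq ∘ suc))

injective⇒strictlySurjective : ∀ {N} {f : Fin N → Fin N} →
                               Injective _≡_ _≡_ f → StrictlySurjective _≡_ f
injective⇒strictlySurjective {suc N} {f} f-injective t with any? (λ a → f a ≟ t)
... | yes hit  = hit
... | no ¬hit = contradiction (injective⇒≤ punched-injective) 1+n≰n
  where
  t≢f : ∀ a → t ≢ f a
  t≢f a eq = ¬hit (a , sym eq)
  punched : Fin (suc N) → Fin N
  punched a = punchOut (t≢f a)
  punched-injective : Injective _≡_ _≡_ punched
  punched-injective eq = f-injective (punchOut-injective (t≢f _) (t≢f _) eq)

module Enumeration {a ℓ} {S : Setoid a ℓ} {N : ℕ} (enum : Inverse (setoid (Fin N)) S) where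
  open Setoid S using (Carrier; _≈_) renaming (sym to ≈-sym; trans to ≈-trans)
  open Inverse enum

  from-injective : Injective _≈_ _≡_ from
  from-injective {x} {y} eq = ≈-trans (≈-sym (strictlyInverseˡ x)) (≈-trans (to-cong eq) (strictlyInverseˡ y))

  any?ₛ : ∀ {p} {P : Pred Carrier p} → (∀ {x y} → x ≈ y → P x → P y) → Decidable P → Dec (∃ P)
  any?ₛ resp P? = map′ (λ (k , Pk) → to k , Pk)
                       (λ (x , Px) → from x , resp (≈-sym (strictlyInverseˡ x)) Px)
                       (any? (P? ∘ to))

  injective⇒strictlySurjectiveₛ : ∀ {f : Carrier → Carrier} →
                                  Injective _≈_ _≈_ f → StrictlySurjective _≈_ f
  injective⇒strictlySurjectiveₛ {f} f-injective t =
    let a , fa≡t = injective⇒strictlySurjective g-injective (from t) in to a , from-injective fa≡t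
    where
    g-injective : Injective _≡_ _≡_ (from ∘ f ∘ to)
    g-injective {a} {b} eq = trans (sym (strictlyInverseʳ a))
      (trans (from-cong (f-injective (from-injective eq))) (strictlyInverseʳ b))

pointwiseEnumeration : ∀ {a} {A : Set a} {q} → Fin q ↔ A → ∀ n →
                       Inverse (setoid (Fin (q ^ n))) (≋-setoid (setoid A) n)
pointwiseEnumeration {q = q} A↔ n = record
  { to        = λ k i → H.to (finToFun k i)
  ; from      = λ x → funToFin (H.from ∘ x)
  ; to-cong   = λ { refl i → refl }
  ; from-cong = λ eq → funToFin-cong (cong H.from ∘ eq)
  ; inverse   = (λ { {x} refl i → trans (cong H.to (finToFun-funToFin (H.from ∘ x) i)) (H.strictlyInverseˡ (x i)) })
              , λ {k} eq → trans (funToFin-cong λ i → trans (cong H.from (eq i)) (H.strictlyInverseʳ _))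
                                  (funToFin-finToFin {n} {q} k)
  }
  where module H = Inverse A↔

module LinearAlgebra {c} (F : Field c) (n : ℕ) where
  open Field F public using (Carrier; _+_; _*_; -_; 0#; 1#; 0≢1; inverse)
  open Affine F n public renaming (trans to translation)

  ring : CommutativeRing c c
  ring = record { isCommutativeRing = Field.isCommutativeRing F }

  open CommutativeRing ring public
    using ( +-assoc; *-comm; *-assoc; zeroˡ; zeroʳ; +-identityˡ; +-identityʳ; *-identityˡ
          ; *-identityʳ; distribˡ; -‿inverseʳ; +-abelianGroup; semiring; commutativeSemiring)
  open RingProperties (CommutativeRing.ring ring) public using (-‿distribˡ-*)
  open AbelianGroupProperties +-abelianGroup public
    using (inverseʳ-unique; xyx⁻¹≈y; ⁻¹-anti-homo‿-; //-rightDividesˡ)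
    renaming (∙-cancelˡ to +-cancelˡ; ∙-cancelʳ to +-cancelʳ)
  open NaturalSolver commutativeSemiring public using (solve; _:+_; _:*_; _:=_)
  module Sum = SumProperties semiring

  -- Defs' ⊕, ⊖, 𝟎 and ≈ᵥ are definitionally the operations of this pointwise group.
  Vᴳ : AbelianGroup c c
  Vᴳ = Pointwise.abelianGroup (Fin n) +-abelianGroup

  module V where
    open AbelianGroup Vᴳ public
    open AbelianGroupProperties Vᴳ public
    open CommutativeSemigroupProperties commutativeSemigroup public using (interchange)

  x+[y-x]≡y : ∀ x y → x + (y + - x) ≡ y
  x+[y-x]≡y x y = trans (sym (+-assoc x y (- x))) (xyx⁻¹≈y x y)

  x-[x-y]≡y : ∀ x y → x + - (x + - y) ≡ y
  x-[x-y]≡y x y = trans (cong (x +_) (⁻¹-anti-homo‿- x y)) (x+[y-x]≡y x y)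

  x*y≡0⇒x≡0 : ∀ {x y} → ¬ y ≡ 0# → x * y ≡ 0# → x ≡ 0#
  x*y≡0⇒x≡0 {x} {y} y≢0 xy≡0 with y⁻¹ , yy⁻¹≡1 ← inverse y y≢0 = begin
    x              ≡⟨ sym (*-identityʳ x) ⟩
    x * 1#         ≡⟨ cong (x *_) (sym yy⁻¹≡1) ⟩
    x * (y * y⁻¹)  ≡⟨ sym (*-assoc x y y⁻¹) ⟩
    x * y * y⁻¹    ≡⟨ cong (_* y⁻¹) xy≡0 ⟩
    0# * y⁻¹       ≡⟨ zeroˡ y⁻¹ ⟩
    0#             ∎
    where open ≡-Reasoning

  inverse-nonzero : ∀ {x y} → x * y ≡ 1# → ¬ y ≡ 0#
  inverse-nonzero {x} xy≡1 y≡0 = 0≢1 (trans (sym (zeroʳ x)) (trans (cong (x *_) (sym y≡0)) xy≡1))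

  ∑≡sum : ∀ {m} (f : Fin m → Carrier) → ∑ f ≡ Sum.sum f
  ∑≡sum {zero}  f = refl
  ∑≡sum {suc m} f = cong (f zero +_) (∑≡sum (f ∘ suc))

  ∑-cong : ∀ {m} {f g : Fin m → Carrier} → f ≗ g → ∑ f ≡ ∑ g
  ∑-cong {f = f} {g} f≗g = trans (∑≡sum f) (trans (Sum.sum-cong-≗ f≗g) (sym (∑≡sum g)))

  ∑-distrib-+ : ∀ {m} (f g : Fin m → Carrier) → ∑ (λ j → f j + g j) ≡ ∑ f + ∑ g
  ∑-distrib-+ f g rewrite ∑≡sum f | ∑≡sum g | ∑≡sum (λ j → f j + g j) = Sum.∑-distrib-+ f g

  ∑-*ˡ : ∀ {m} a (f : Fin m → Carrier) → ∑ (λ j → a * f j) ≡ a * ∑ f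
  ∑-*ˡ a f rewrite ∑≡sum f | ∑≡sum (λ j → a * f j) = sym (Sum.*-distribˡ-sum a f)

  ∑-*ʳ : ∀ {m} a (f : Fin m → Carrier) → ∑ (λ j → f j * a) ≡ ∑ f * a
  ∑-*ʳ a f rewrite ∑≡sum f | ∑≡sum (λ j → f j * a) = sym (Sum.*-distribʳ-sum a f)

  ∑-comm : ∀ {k m} (f : Fin k → Fin m → Carrier) →
           ∑ (λ i → ∑ (f i)) ≡ ∑ (λ j → ∑ (λ i → f i j))
  ∑-comm f = begin
    ∑ (λ i → ∑ (f i))                     ≡⟨ trans (∑-cong (∑≡sum ∘ f)) (∑≡sum (λ i → Sum.sum (f i))) ⟩
    Sum.sum (λ i → Sum.sum (f i))         ≡⟨ Sum.∑-comm f ⟩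
    Sum.sum (λ j → Sum.sum (λ i → f i j)) ≡⟨ sym (trans (∑-cong λ j → ∑≡sum (λ i → f i j))
                                                         (∑≡sum (λ j → Sum.sum (λ i → f i j)))) ⟩
    ∑ (λ j → ∑ (λ i → f i j))             ∎
    where open ≡-Reasoning

  ∑-single : ∀ {m} (f : Fin m → Carrier) k → (∀ j → j ≢ k → f j ≡ 0#) → ∑ f ≡ f k
  ∑-single {suc m} f k vanishes = begin
    ∑ f                              ≡⟨ ∑≡sum f ⟩
    Sum.sum f                        ≡⟨ Sum.sum-remove f ⟩
    f k + Sum.sum (f ∘ punchIn k) ≡⟨ cong (f k +_) (trans (Sum.sum-cong-≗ λ j → vanishes _ (punchInᵢ≢i k j))
                                                         (Sum.sum-replicate-zero m)) ⟩
    f k + 0#                         ≡⟨ +-identityʳ (f k) ⟩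
    f k                              ∎
    where open ≡-Reasoning

  I-diagonal : ∀ i → I i i ≡ 1#
  I-diagonal i with i ≟ i
  ... | yes _  = refl
  ... | no i≢i = contradiction refl i≢i

  I-offDiagonal : ∀ {i j} → i ≢ j → I i j ≡ 0#
  I-offDiagonal {i} {j} i≢j with i ≟ j
  ... | yes i≡j = contradiction i≡j i≢j
  ... | no _    = refl

  ∑-δ : ∀ k (f : Vec) → ∑ (λ j → I k j * f j) ≡ f k
  ∑-δ k f = begin
    ∑ (λ j → I k j * f j)  ≡⟨ ∑-single _ k (λ j j≢k → trans (cong (_* f j) (I-offDiagonal (j≢k ∘ sym))) (zeroˡ _)) ⟩
    I k k * f k            ≡⟨ cong (_* f k) (I-diagonal k) ⟩
    1# * f k               ≡⟨ *-identityˡ (f k) ⟩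
    f k                    ∎
    where open ≡-Reasoning

  _⋆_ : Carrier → Vec → Vec
  (a ⋆ x) i = a * x i

  dot : Vec → Vec → Carrier
  dot φ x = ∑ λ j → φ j * x j

  dot-congʳ : ∀ φ {x y} → x ≈ᵥ y → dot φ x ≡ dot φ y
  dot-congʳ φ x≈y = ∑-cong λ j → cong (φ j *_) (x≈y j)

  dot-comm : ∀ φ x → dot φ x ≡ dot x φ
  dot-comm φ x = ∑-cong λ j → *-comm (φ j) (x j)

  dot-⊕ʳ : ∀ φ x y → dot φ (x ⊕ y) ≡ dot φ x + dot φ y
  dot-⊕ʳ φ x y = trans (∑-cong λ j → distribˡ (φ j) (x j) (y j))
                       (∑-distrib-+ (λ j → φ j * x j) (λ j → φ j * y j))

  dot-⋆ʳ : ∀ φ a x → dot φ (a ⋆ x) ≡ a * dot φ x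
  dot-⋆ʳ φ a x = trans (∑-cong λ j → solve 3 (λ f a x → f :* (a :* x) := a :* (f :* x)) refl (φ j) a (x j))
                       (∑-*ˡ a (λ j → φ j * x j))

  dot-𝟎ʳ : ∀ φ → dot φ 𝟎 ≡ 0#
  dot-𝟎ʳ φ = begin
    dot φ 𝟎                 ≡⟨ ∑-cong (λ j → trans (zeroʳ (φ j)) (sym (zeroˡ (φ j)))) ⟩
    ∑ (λ j → 0# * φ j)      ≡⟨ ∑-*ˡ 0# φ ⟩
    0# * ∑ φ                ≡⟨ zeroˡ (∑ φ) ⟩
    0#                      ∎
    where open ≡-Reasoning

  dot-⊖ʳ : ∀ φ x → dot φ (⊖ x) ≡ - dot φ x
  dot-⊖ʳ φ x = inverseʳ-unique (dot φ x) (dot φ (⊖ x)) (begin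
    dot φ x + dot φ (⊖ x)   ≡⟨ sym (dot-⊕ʳ φ x (⊖ x)) ⟩
    dot φ (x ⊕ (⊖ x))         ≡⟨ dot-congʳ φ (V.inverseʳ x) ⟩
    dot φ 𝟎                 ≡⟨ dot-𝟎ʳ φ ⟩
    0#                      ∎)
    where open ≡-Reasoning

  dot-⊕ˡ : ∀ φ ψ x → dot (φ ⊕ ψ) x ≡ dot φ x + dot ψ x
  dot-⊕ˡ φ ψ x = trans (dot-comm (φ ⊕ ψ) x) (trans (dot-⊕ʳ x φ ψ) (cong₂ _+_ (dot-comm x φ) (dot-comm x ψ)))

  dot-⋆ˡ : ∀ a φ x → dot (a ⋆ φ) x ≡ a * dot φ x
  dot-⋆ˡ a φ x = trans (dot-comm (a ⋆ φ) x) (trans (dot-⋆ʳ x a φ) (cong (a *_) (dot-comm x φ)))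

  dot-unit : ∀ k x → dot (I k) x ≡ x k
  dot-unit k x = ∑-δ k x

  ·-cong : ∀ A {x y} → x ≈ᵥ y → (A · x) ≈ᵥ (A · y)
  ·-cong A x≈y i = dot-congʳ (A i) x≈y

  ·-congˡ : ∀ {A B} x → A ≈ₘ B → (A · x) ≈ᵥ (B · x)
  ·-congˡ x A≈B i = ∑-cong λ j → cong (_* x j) (A≈B i j)

  ·-⊕ : ∀ A x y → (A · (x ⊕ y)) ≈ᵥ ((A · x) ⊕ (A · y))
  ·-⊕ A x y i = dot-⊕ʳ (A i) x y

  ·-⋆ : ∀ A a x → (A · (a ⋆ x)) ≈ᵥ (a ⋆ (A · x))
  ·-⋆ A a x i = dot-⋆ʳ (A i) a x

  ·-𝟎 : ∀ A → (A · 𝟎) ≈ᵥ 𝟎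
  ·-𝟎 A i = dot-𝟎ʳ (A i)

  ·-⊖ : ∀ A x → (A · (⊖ x)) ≈ᵥ (⊖ (A · x))
  ·-⊖ A x i = dot-⊖ʳ (A i) x

  I-· : ∀ x → (I · x) ≈ᵥ x
  I-· x i = ∑-δ i x

  ·-unit : ∀ A k i → (A · I k) i ≡ A i k
  ·-unit A k i = trans (dot-comm (A i) (I k)) (dot-unit k (A i))

  ⊗-· : ∀ A B x → ((A ⊗ B) · x) ≈ᵥ (A · (B · x))
  ⊗-· A B x i = begin
    ∑ (λ k → ∑ (λ j → A i j * B j k) * x k)  ≡⟨ ∑-cong (λ k → sym (∑-*ʳ (x k) (λ j → A i j * B j k))) ⟩
    ∑ (λ k → ∑ (λ j → A i j * B j k * x k))  ≡⟨ ∑-comm (λ k j → A i j * B j k * x k) ⟩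
    ∑ (λ j → ∑ (λ k → A i j * B j k * x k))  ≡⟨ ∑-cong (λ j → trans (∑-cong λ k → *-assoc (A i j) (B j k) (x k))
                                                                   (∑-*ˡ (A i j) (λ k → B j k * x k))) ⟩
    ∑ (λ j → A i j * (B · x) j)              ∎
    where open ≡-Reasoning

  ·-extensional : ∀ {A B} → (∀ x → (A · x) ≈ᵥ (B · x)) → A ≈ₘ B
  ·-extensional {A} {B} A≈B i k = trans (sym (·-unit A k i)) (trans (A≈B (I k) i) (·-unit B k i))

  unit-nonzero : ∀ k → ¬ I k ≈ᵥ 𝟎
  unit-nonzero k Ik≈0 = 0≢1 (trans (sym (Ik≈0 k)) (I-diagonal k))

  fromActions : (A B : Mat) → (∀ x → (B · (A · x)) ≈ᵥ x) → (∀ x → (A · (B · x)) ≈ᵥ x) → GL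
  fromActions A B BA≈id AB≈id = mkGL A B (⊗≈I BA≈id) (⊗≈I AB≈id)
    where
    ⊗≈I : ∀ {P Q} → (∀ x → (P · (Q · x)) ≈ᵥ x) → (P ⊗ Q) ≈ₘ I
    ⊗≈I {P} {Q} PQ≈id = ·-extensional λ x → V.trans (⊗-· P Q x) (V.trans (PQ≈id x) (V.sym (I-· x)))

  inv-· : ∀ G x → (inv G · (mat G · x)) ≈ᵥ x
  inv-· G x = V.trans (V.sym (⊗-· (inv G) (mat G) x)) (V.trans (·-congˡ x (linv G)) (I-· x))

  mat-· : ∀ G x → (mat G · (inv G · x)) ≈ᵥ x
  mat-· G x = V.trans (V.sym (⊗-· (mat G) (inv G) x)) (V.trans (·-congˡ x (rinv G)) (I-· x))

  mat-injective : ∀ G {x y} → (mat G · x) ≈ᵥ (mat G · y) → x ≈ᵥ y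
  mat-injective G {x} {y} Gx≈Gy =
    V.trans (V.sym (inv-· G x)) (V.trans (·-cong (inv G) Gx≈Gy) (inv-· G y))

  idᴳ : GL
  idᴳ = fromActions I I (λ x → V.trans (I-· (I · x)) (I-· x)) (λ x → V.trans (I-· (I · x)) (I-· x))

  _⁻¹ᴳ : GL → GL
  G ⁻¹ᴳ = mkGL (inv G) (mat G) (rinv G) (linv G)

  _∙ᴳ_ : GL → GL → GL
  G ∙ᴳ H = fromActions (mat G ⊗ mat H) (inv H ⊗ inv G) (cancel H G) (cancel (G ⁻¹ᴳ) (H ⁻¹ᴳ))
    where
    cancel : ∀ K L x → ((inv K ⊗ inv L) · ((mat L ⊗ mat K) · x)) ≈ᵥ x
    cancel K L x = begin
      (inv K ⊗ inv L) · ((mat L ⊗ mat K) · x)   ≈⟨ ⊗-· (inv K) (inv L) _ ⟩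
      inv K · (inv L · ((mat L ⊗ mat K) · x))   ≈⟨ ·-cong (inv K) (·-cong (inv L) (⊗-· (mat L) (mat K) x)) ⟩
      inv K · (inv L · (mat L · (mat K · x)))   ≈⟨ ·-cong (inv K) (inv-· L (mat K · x)) ⟩
      inv K · (mat K · x)                       ≈⟨ inv-· K x ⟩
      x                                         ∎
      where open SetoidReasoning V.setoid

  displacement-injective : ∀ A → (∀ z → (A · z) ≈ᵥ z → z ≈ᵥ 𝟎) →
                           Injective _≈ᵥ_ _≈ᵥ_ (λ x → x ⊕ (⊖ (A · x)))
  displacement-injective A fixedFree {x} {y} Dx≈Dy =
    V.x∙y⁻¹≈ε⇒x≈y x y (fixedFree r (V.sym (V.x∙y⁻¹≈ε⇒x≈y r (A · r) Dr≈0)))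
    where
    open SetoidReasoning V.setoid
    D : Vec → Vec
    D x = x ⊕ (⊖ (A · x))
    r = x ⊕ (⊖ y)
    Dr≈0 : D r ≈ᵥ 𝟎
    Dr≈0 = begin
      r ⊕ (⊖ (A · r))                             ≈⟨ V.∙-congˡ (V.⁻¹-cong (·-⊕ A x (⊖ y))) ⟩
      r ⊕ (⊖ ((A · x) ⊕ (A · (⊖ y))))             ≈⟨ V.∙-congˡ (V.⁻¹-cong (V.∙-congˡ (·-⊖ A y))) ⟩
      r ⊕ (⊖ ((A · x) ⊕ (⊖ (A · y))))             ≈⟨ V.∙-congˡ (V.sym (V.⁻¹-∙-comm (A · x) (⊖ (A · y)))) ⟩
      r ⊕ ((⊖ (A · x)) ⊕ (⊖ (⊖ (A · y))))         ≈⟨ V.interchange x (⊖ y) (⊖ (A · x)) (⊖ (⊖ (A · y))) ⟩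
      D x ⊕ ((⊖ y) ⊕ (⊖ (⊖ (A · y))))             ≈⟨ V.∙-congˡ (V.⁻¹-∙-comm y (⊖ (A · y))) ⟩
      D x ⊕ (⊖ (D y))                             ≈⟨ V.x≈y⇒x∙y⁻¹≈ε Dx≈Dy ⟩
      𝟎                                           ∎

module Transitivity {c} (F : Field c) (n : ℕ) where
  open LinearAlgebra F n

  transvection : Vec → Vec → Carrier → Mat
  transvection u φ a i j = I i j + a * (u i * φ j)

  transvection-· : ∀ u φ a x → (transvection u φ a · x) ≈ᵥ (x ⊕ ((a * dot φ x) ⋆ u))
  transvection-· u φ a x i = begin
    ∑ (λ j → (I i j + a * (u i * φ j)) * x j)
      ≡⟨ ∑-cong (λ j → solve 5 (λ e a u f x → (e :+ a :* (u :* f)) :* x := e :* x :+ (a :* u) :* (f :* x))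
                               refl (I i j) a (u i) (φ j) (x j)) ⟩
    ∑ (λ j → I i j * x j + (a * u i) * (φ j * x j))
      ≡⟨ ∑-distrib-+ (λ j → I i j * x j) (λ j → (a * u i) * (φ j * x j)) ⟩
    ∑ (λ j → I i j * x j) + ∑ (λ j → (a * u i) * (φ j * x j))
      ≡⟨ cong₂ _+_ (∑-δ i x) (∑-*ˡ (a * u i) (λ j → φ j * x j)) ⟩
    x i + (a * u i) * dot φ x
      ≡⟨ cong (x i +_) (solve 3 (λ a u d → (a :* u) :* d := (a :* d) :* u) refl a (u i) (dot φ x)) ⟩
    x i + (a * dot φ x) * u i ∎
    where open ≡-Reasoning

  -- T a ∘ T b = T (a + b + a b φ(u)), where T a x = x + a φ(x) u.
  transvection-∘ : ∀ u φ a b → a + b + a * b * dot φ u ≡ 0# →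
                   ∀ x → (transvection u φ a · (transvection u φ b · x)) ≈ᵥ x
  transvection-∘ u φ a b vanishes x i = begin
    (transvection u φ a · (transvection u φ b · x)) i
      ≡⟨ transvection-· u φ a _ i ⟩
    y i + (a * dot φ y) * u i
      ≡⟨ cong₂ (λ s t → s + (a * t) * u i) (transvection-· u φ b x i) (dot-congʳ φ (transvection-· u φ b x)) ⟩
    (x i + (b * d) * u i) + (a * dot φ (x ⊕ ((b * d) ⋆ u))) * u i
      ≡⟨ cong (λ t → (x i + (b * d) * u i) + (a * t) * u i) (trans (dot-⊕ʳ φ x _) (cong (d +_) (dot-⋆ʳ φ (b * d) u))) ⟩
    (x i + (b * d) * u i) + (a * (d + (b * d) * dot φ u)) * u i
      ≡⟨ solve 6 (λ x a b d e u → (x :+ (b :* d) :* u) :+ (a :* (d :+ (b :* d) :* e)) :* u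
                               := x :+ (a :+ b :+ a :* b :* e) :* (d :* u)) refl (x i) a b d (dot φ u) (u i) ⟩
    x i + (a + b + a * b * dot φ u) * (d * u i)
      ≡⟨ cong (λ t → x i + t * (d * u i)) vanishes ⟩
    x i + 0# * (d * u i)
      ≡⟨ trans (cong (x i +_) (zeroˡ _)) (+-identityʳ (x i)) ⟩
    x i ∎
    where
    open ≡-Reasoning
    d = dot φ x
    y = transvection u φ b · x

  -- The shape is the hypothesis of transvection-∘ for a = 1, b = −s.
  1-s[1+d]≡0 : ∀ s d → s * (1# + d) ≡ 1# → 1# + - s + 1# * - s * d ≡ 0#
  1-s[1+d]≡0 s d s[1+d]≡1 = begin
    1# + - s + 1# * - s * d    ≡⟨ cong (λ t → 1# + - s + t * d) (*-identityˡ (- s)) ⟩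
    1# + - s + - s * d         ≡⟨ +-assoc 1# (- s) (- s * d) ⟩
    1# + (- s + - s * d)       ≡⟨ cong (λ t → 1# + (t + - s * d)) (sym (*-identityʳ (- s))) ⟩
    1# + (- s * 1# + - s * d)  ≡⟨ cong (1# +_) (sym (distribˡ (- s) 1# d)) ⟩
    1# + - s * (1# + d)        ≡⟨ cong (1# +_) (sym (-‿distribˡ-* s (1# + d))) ⟩
    1# + - (s * (1# + d))      ≡⟨ cong (λ t → 1# + - t) s[1+d]≡1 ⟩
    1# + - 1#                  ≡⟨ -‿inverseʳ 1# ⟩
    0#                         ∎
    where open ≡-Reasoning

  transvectionᴳ : ∀ u φ s → s * (1# + dot φ u) ≡ 1# → GL
  transvectionᴳ u φ s s[1+d]≡1 =
    fromActions (transvection u φ 1#) (transvection u φ (- s))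
      (transvection-∘ u φ (- s) 1# (trans (swap (- s) 1# d) (1-s[1+d]≡0 s d s[1+d]≡1)))
      (transvection-∘ u φ 1# (- s) (1-s[1+d]≡0 s d s[1+d]≡1))
    where
    d = dot φ u
    swap : ∀ a b d → a + b + a * b * d ≡ b + a + b * a * d
    swap = solve 3 (λ a b d → a :+ b :+ a :* b :* d := b :+ a :+ b :* a :* d) refl

  Separates : Vec → Vec → Vec → Set c
  Separates φ w z = dot φ w ≡ 1# × ¬ dot φ z ≡ 0#

  separated⇒related : ∀ {w z} φ → Separates φ w z → ∃ λ B → (mat B · w) ≈ᵥ z
  separated⇒related {w} {z} φ (φw≡1 , φz≢0) with s , φz*s≡1 ← inverse (dot φ z) φz≢0 =
    transvectionᴳ u φ s s[1+φu]≡1 , moves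
    where
    open ≡-Reasoning
    u = z ⊕ (⊖ w)
    s[1+φu]≡1 : s * (1# + dot φ u) ≡ 1#
    s[1+φu]≡1 = begin
      s * (1# + dot φ u)              ≡⟨ cong (λ t → s * (1# + t)) (trans (dot-⊕ʳ φ z (⊖ w)) (cong (dot φ z +_) (dot-⊖ʳ φ w))) ⟩
      s * (1# + (dot φ z + - dot φ w)) ≡⟨ cong (λ t → s * (1# + (dot φ z + - t))) φw≡1 ⟩
      s * (1# + (dot φ z + - 1#))      ≡⟨ cong (s *_) (trans (sym (+-assoc 1# (dot φ z) (- 1#))) (xyx⁻¹≈y 1# (dot φ z))) ⟩
      s * dot φ z                      ≡⟨ trans (*-comm s (dot φ z)) φz*s≡1 ⟩
      1#                               ∎
    moves : (transvection u φ 1# · w) ≈ᵥ z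
    moves = V.trans (transvection-· u φ 1# w) λ i → begin
      w i + (1# * dot φ w) * (z i + - w i) ≡⟨ cong (λ t → w i + t * (z i + - w i)) (trans (*-identityˡ (dot φ w)) φw≡1) ⟩
      w i + 1# * (z i + - w i)             ≡⟨ cong (w i +_) (*-identityˡ (z i + - w i)) ⟩
      w i + (z i + - w i)                  ≡⟨ trans (sym (+-assoc (w i) (z i) (- w i))) (xyx⁻¹≈y (w i) (z i)) ⟩
      z i                                  ∎

  dot-⋆unit : ∀ a k x → dot (a ⋆ I k) x ≡ a * x k
  dot-⋆unit a k x = trans (dot-⋆ˡ a (I k) x) (cong (a *_) (dot-unit k x))

  coordinate-separating : ∀ {w z} k → ¬ w k ≡ 0# → ¬ z k ≡ 0# → ∃ λ φ → Separates φ w z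
  coordinate-separating {w} {z} k wk≢0 zk≢0 with a , wk*a≡1 ← inverse (w k) wk≢0 =
    a ⋆ I k ,
    trans (dot-⋆unit a k w) (trans (*-comm a (w k)) wk*a≡1) ,
    λ φz≡0 → zk≢0 (x*y≡0⇒x≡0 (inverse-nonzero wk*a≡1)
                              (trans (*-comm (z k) a) (trans (sym (dot-⋆unit a k z)) φz≡0)))

  module _ (_≟ᶠ_ : DecidableEquality Carrier) where

    nonzero-coordinate : ∀ {x} → ¬ x ≈ᵥ 𝟎 → ∃ λ i → ¬ x i ≡ 0#
    nonzero-coordinate {x} = ¬∀⟶∃¬ n _ (λ i → x i ≟ᶠ 0#)

    separating : ∀ {w z} → ¬ w ≈ᵥ 𝟎 → ¬ z ≈ᵥ 𝟎 → ∃ λ φ → Separates φ w z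
    separating {w} {z} w≉0 z≉0 with nonzero-coordinate w≉0 | nonzero-coordinate z≉0
    ... | i , wi≢0 | k , zk≢0 with z i ≟ᶠ 0# | w k ≟ᶠ 0#
    ...   | no zi≢0  | _        = coordinate-separating i wi≢0 zi≢0
    ...   | yes _    | no wk≢0  = coordinate-separating k wk≢0 zk≢0
    ...   | yes zi≡0 | yes wk≡0 with a , wi*a≡1 ← inverse (w i) wi≢0 =
      (a ⋆ I i) ⊕ I k ,
      trans (dot-pair w) (trans (cong₂ _+_ (trans (*-comm a (w i)) wi*a≡1) wk≡0) (+-identityʳ 1#)) ,
      λ φz≡0 → zk≢0 (trans (sym (trans (cong (_+ z k) (trans (cong (a *_) zi≡0) (zeroʳ a))) (+-identityˡ (z k))))
                           (trans (sym (dot-pair z)) φz≡0))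
      where
      dot-pair : ∀ x → dot ((a ⋆ I i) ⊕ I k) x ≡ a * x i + x k
      dot-pair x = trans (dot-⊕ˡ (a ⋆ I i) (I k) x) (cong₂ _+_ (dot-⋆unit a i x) (dot-unit k x))

    GL-transitive : ∀ {w z} → ¬ w ≈ᵥ 𝟎 → ¬ z ≈ᵥ 𝟎 → ∃ λ B → (mat B · w) ≈ᵥ z
    GL-transitive w≉0 z≉0 = let φ , φ-separates = separating w≉0 z≉0 in separated⇒related φ φ-separates

module AffineGroup {c} (F : Field c) (n : ℕ) where
  open LinearAlgebra F n
  open Transitivity F n

  translate : Vec → AGL
  translate t = aff idᴳ t

  linear : GL → AGL
  linear B = aff B 𝟎

  mat-product : ∀ g h k → IsProduct g h k → ∀ x → (mat (lin k) · x) ≈ᵥ (mat (lin g) · (mat (lin h) · x))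
  mat-product g h k (k≈gh , _) x = V.trans (·-congˡ x k≈gh) (⊗-· (mat (lin g)) (mat (lin h)) x)

  mat-identity : ∀ k → IsIdentity k → ∀ x → (mat (lin k) · x) ≈ᵥ x
  mat-identity k (k≈I , _) x = V.trans (·-congˡ x k≈I) (I-· x)

  act-cong : ∀ g {x y} → x ≈ᵥ y → act g x ≈ᵥ act g y
  act-cong g x≈y i = cong (_+ translation g i) (·-cong (mat (lin g)) x≈y i)

  act-product : ∀ g h k → IsProduct g h k → ∀ x → act k x ≈ᵥ act g (act h x)
  act-product g h k gh≡k@(_ , tk≈) x i = begin
    (mat (lin k) · x) i + translation k i                         ≡⟨ cong₂ _+_ (mat-product g h k gh≡k x i) (tk≈ i) ⟩
    (G · (H · x)) i + ((G · translation h) i + translation g i)   ≡⟨ sym (+-assoc _ _ _) ⟩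
    ((G · (H · x)) i + (G · translation h) i) + translation g i   ≡⟨ cong (_+ translation g i) (sym (·-⊕ G (H · x) (translation h) i)) ⟩
    (G · ((H · x) ⊕ translation h)) i + translation g i           ∎
    where
    open ≡-Reasoning
    G = mat (lin g)
    H = mat (lin h)

  act-identity : ∀ k → IsIdentity k → ∀ x → act k x ≈ᵥ x
  act-identity k k≡1@(_ , tk≈0) x i = trans (cong₂ _+_ (mat-identity k k≡1 x i) (tk≈0 i)) (+-identityʳ (x i))

  act-injective : ∀ g {x y} → act g x ≈ᵥ act g y → x ≈ᵥ y
  act-injective g gx≈gy = mat-injective (lin g) λ i → +-cancelʳ (translation g i) _ _ (gx≈gy i)

  pointStab-isSubgroup : ∀ p → IsSubgroup (PointStab p)
  pointStab-isSubgroup p =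
    (λ k k≡1 → act-identity k k≡1 p) ,
    (λ g h k gp≈p hp≈p gh≡k → V.trans (act-product g h k gh≡k p) (V.trans (act-cong g hp≈p) gp≈p)) ,
    (λ g h k gp≈p gh≡k k≡1 → act-injective g
       (V.trans (V.sym (act-product g h k gh≡k p)) (V.trans (act-identity k k≡1 p) (V.sym gp≈p))))

  translate-moves : ∀ p {t} → ¬ t ≈ᵥ 𝟎 → ¬ PointStab p (translate t)
  translate-moves p t≉0 p+t≈p = t≉0 λ i →
    +-cancelˡ (p i) _ _ (trans (cong (_+ _) (sym (I-· p i))) (trans (p+t≈p i) (sym (+-identityʳ (p i)))))

  pointStab-proper : ∀ p → Fin n → ∃ λ g → ¬ PointStab p g
  pointStab-proper p j = translate (I j) , translate-moves p (unit-nonzero j)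

  InSpan-resp : ∀ {w x y} → x ≈ᵥ y → InSpan w x → InSpan w y
  InSpan-resp x≈y (a , x≈aw) = a , λ i → trans (sym (x≈y i)) (x≈aw i)

  InSpan-self : ∀ w → InSpan w w
  InSpan-self w = 1# , λ i → sym (*-identityˡ (w i))

  lineImage⇒LineStab : ∀ w g → InSpan w (mat (lin g) · w) → LineStab w g
  lineImage⇒LineStab w g (b , gw≈bw) v (a , v≈aw) = a * b , λ i → begin
    (G · v) i        ≡⟨ ·-cong G v≈aw i ⟩
    (G · (a ⋆ w)) i  ≡⟨ ·-⋆ G a w i ⟩
    a * (G · w) i    ≡⟨ cong (a *_) (gw≈bw i) ⟩
    a * (b * w i)    ≡⟨ sym (*-assoc a b (w i)) ⟩
    a * b * w i      ∎
    where
    open ≡-Reasoning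
    G = mat (lin g)

  eigenvalue-nonzero : ∀ G {w b} → ¬ w ≈ᵥ 𝟎 → (mat G · w) ≈ᵥ (b ⋆ w) → ¬ b ≡ 0#
  eigenvalue-nonzero G {w} w≉0 Gw≈bw b≡0 = w≉0 (mat-injective G λ i →
    trans (Gw≈bw i) (trans (cong (_* w i) b≡0) (trans (zeroˡ (w i)) (sym (·-𝟎 (mat G) i)))))

  lineStab-isSubgroup : ∀ w → ¬ w ≈ᵥ 𝟎 → IsSubgroup (LineStab w)
  lineStab-isSubgroup w w≉0 =
    (λ k k≡1 v v∈⟨w⟩ → InSpan-resp (V.sym (mat-identity k k≡1 v)) v∈⟨w⟩) ,
    (λ g h k g∈U h∈U gh≡k v v∈⟨w⟩ → InSpan-resp (V.sym (mat-product g h k gh≡k v)) (g∈U _ (h∈U v v∈⟨w⟩))) ,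
    inverse-closed
    where
    inverse-closed : ∀ g h k → LineStab w g → IsProduct g h k → IsIdentity k → LineStab w h
    inverse-closed g h k g∈U gh≡k k≡1
      with b , Gw≈bw ← g∈U w (InSpan-self w)
      with b⁻¹ , bb⁻¹≡1 ← inverse b (eigenvalue-nonzero (lin g) w≉0 Gw≈bw) =
      lineImage⇒LineStab w h (b⁻¹ , mat-injective (lin g) (V.trans GHw≈w (V.sym Gb⁻¹w≈w)))
      where
      G = mat (lin g)
      H = mat (lin h)
      GHw≈w : (G · (H · w)) ≈ᵥ w
      GHw≈w = V.trans (V.sym (mat-product g h k gh≡k w)) (mat-identity k k≡1 w)
      Gb⁻¹w≈w : (G · (b⁻¹ ⋆ w)) ≈ᵥ w
      Gb⁻¹w≈w i = begin
        (G · (b⁻¹ ⋆ w)) i ≡⟨ ·-⋆ G b⁻¹ w i ⟩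
        b⁻¹ * (G · w) i   ≡⟨ cong (b⁻¹ *_) (Gw≈bw i) ⟩
        b⁻¹ * (b * w i)   ≡⟨ sym (*-assoc b⁻¹ b (w i)) ⟩
        b⁻¹ * b * w i     ≡⟨ cong (_* w i) (trans (*-comm b⁻¹ b) bb⁻¹≡1) ⟩
        1# * w i          ≡⟨ *-identityˡ (w i) ⟩
        w i               ∎
        where open ≡-Reasoning

  unit-notInSpan : ∀ {w i j} → ¬ w i ≡ 0# → j ≢ i → ¬ InSpan w (I j)
  unit-notInSpan {w} {i} {j} wi≢0 j≢i (a , Ij≈aw) = 0≢1 (begin
    0#        ≡⟨ sym (zeroˡ (w j)) ⟩
    0# * w j  ≡⟨ cong (_* w j) (sym a≡0) ⟩
    a * w j   ≡⟨ sym (Ij≈aw j) ⟩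
    I j j     ≡⟨ I-diagonal j ⟩
    1#        ∎)
    where
    open ≡-Reasoning
    a≡0 : a ≡ 0#
    a≡0 = x*y≡0⇒x≡0 wi≢0 (trans (sym (Ij≈aw i)) (I-offDiagonal j≢i))

  linear-conjugate : ∀ U B g → U (aff ((B ⁻¹ᴳ) ∙ᴳ (lin g ∙ᴳ B)) (inv B · translation g)) →
                     InConjugate U (linear B) g
  linear-conjugate U B g u∈U =
    _ , u∈U , aff (lin g ∙ᴳ B) (translation g) ,
    (AB≈B[B⁻¹AB] , λ i → sym (trans (+-identityʳ _) (mat-· B (translation g) i))) ,
    ((λ _ _ → refl) , λ i → sym (trans (cong (_+ translation g i) (·-𝟎 A i)) (+-identityˡ _)))
    where
    A = mat (lin g)
    AB≈B[B⁻¹AB] : (A ⊗ mat B) ≈ₘ (mat B ⊗ (inv B ⊗ (A ⊗ mat B)))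
    AB≈B[B⁻¹AB] = ·-extensional λ x → V.sym (V.trans (⊗-· (mat B) _ x)
      (V.trans (·-cong (mat B) (⊗-· (inv B) (A ⊗ mat B) x)) (mat-· B ((A ⊗ mat B) · x))))

  translate-conjugate : ∀ U t g → U (aff (lin g) (act g t ⊕ (⊖ t))) → InConjugate U (translate t) g
  translate-conjugate U t g u∈U =
    _ , u∈U , aff (lin g) (act g t) ,
    (A≈I⊗A , λ i → sym (trans (cong (_+ t i) (I-· _ i)) (//-rightDividesˡ (t i) (act g t i)))) ,
    (A≈A⊗I , λ _ → refl)
    where
    A = mat (lin g)
    A≈I⊗A : A ≈ₘ (I ⊗ A)
    A≈I⊗A = ·-extensional λ x → V.sym (V.trans (⊗-· I A x) (I-· (A · x)))
    A≈A⊗I : A ≈ₘ (A ⊗ I)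
    A≈A⊗I = ·-extensional λ x → V.sym (V.trans (⊗-· A I x) (·-cong A (I-· x)))

  fixedPoint⇒conjugate : ∀ p g {y} → act g y ≈ᵥ y → ∃ λ x → InConjugate (PointStab p) x g
  fixedPoint⇒conjugate p g {y} gy≈y = translate t , translate-conjugate (PointStab p) t g p-fixed
    where
    A = mat (lin g)
    v = translation g
    t = y ⊕ (⊖ p)
    p-fixed : PointStab p (aff (lin g) (act g t ⊕ (⊖ t)))
    p-fixed i = begin
      (A · p) i + ((A · t) i + v i + - t i)  ≡⟨ solve 4 (λ a b c d → a :+ (b :+ c :+ d) := a :+ b :+ c :+ d) refl _ _ _ _ ⟩
      (A · p) i + (A · t) i + v i + - t i    ≡⟨ cong (λ s → s + v i + - t i) (sym (·-⊕ A p t i)) ⟩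
      (A · (p ⊕ t)) i + v i + - t i          ≡⟨ cong (λ s → (s + v i) + - t i) (·-cong A (λ j → x+[y-x]≡y (p j) (y j)) i) ⟩
      act g y i + - t i                      ≡⟨ cong (_+ - t i) (gy≈y i) ⟩
      y i + - (y i + - p i)                  ≡⟨ x-[x-y]≡y (y i) (p i) ⟩
      p i                                    ∎
      where open ≡-Reasoning

  module _ (_≟ᶠ_ : DecidableEquality Carrier) where

    lineStab-proper : ∀ w → ¬ w ≈ᵥ 𝟎 → (∀ (i : Fin n) → ∃ λ j → j ≢ i) →
                      ∃ λ g → ¬ LineStab w g
    lineStab-proper w w≉0 distinct =
      let i , wi≢0 = nonzero-coordinate _≟ᶠ_ w≉0
          j , j≢i = distinct i
          B , Bw≈Ij = GL-transitive _≟ᶠ_ w≉0 (unit-nonzero j)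
      in linear B , λ B∈U → unit-notInSpan wi≢0 j≢i (InSpan-resp Bw≈Ij (B∈U w (InSpan-self w)))

    fixedVector⇒conjugate : ∀ w g {z} → ¬ w ≈ᵥ 𝟎 → ¬ z ≈ᵥ 𝟎 →
                            (mat (lin g) · z) ≈ᵥ z → ∃ λ x → InConjugate (LineStab w) x g
    fixedVector⇒conjugate w g {z} w≉0 z≉0 Az≈z =
      let B , Bw≈z = GL-transitive _≟ᶠ_ w≉0 z≉0
      in linear B , linear-conjugate (LineStab w) B g
           (lineImage⇒LineStab w (aff ((B ⁻¹ᴳ) ∙ᴳ (lin g ∙ᴳ B)) (inv B · translation g))
             (InSpan-resp (V.sym (w-fixed B Bw≈z)) (InSpan-self w)))
      where
      open SetoidReasoning V.setoid
      A = mat (lin g)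
      w-fixed : ∀ B → (mat B · w) ≈ᵥ z → ((inv B ⊗ (A ⊗ mat B)) · w) ≈ᵥ w
      w-fixed B Bw≈z = begin
        (inv B ⊗ (A ⊗ mat B)) · w  ≈⟨ V.trans (⊗-· (inv B) _ w) (·-cong (inv B) (⊗-· A (mat B) w)) ⟩
        inv B · (A · (mat B · w))  ≈⟨ ·-cong (inv B) (V.trans (·-cong A Bw≈z) Az≈z) ⟩
        inv B · z                  ≈⟨ ·-cong (inv B) (V.sym Bw≈z) ⟩
        inv B · (mat B · w)        ≈⟨ inv-· B w ⟩
        w                          ∎

module FiniteAffineGroup {c} (F : Field c) {q} (finite : HasOrder F q) (n : ℕ) where
  open LinearAlgebra F n
  open AffineGroup F n
  open Enumeration (pointwiseEnumeration finite n) using (any?ₛ; injective⇒strictlySurjectiveₛ)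

  _≟ᶠ_ : DecidableEquality Carrier
  _≟ᶠ_ = inj⇒≟ (↔⇒↣ (↔-sym finite))

  _≈ᵥ?_ : ∀ x y → Dec (x ≈ᵥ y)
  x ≈ᵥ? y = all? λ i → x i ≟ᶠ y i

  fixedFree⇒fixedPoint : ∀ g → (∀ z → (mat (lin g) · z) ≈ᵥ z → z ≈ᵥ 𝟎) → ∃ λ y → act g y ≈ᵥ y
  fixedFree⇒fixedPoint g fixedFree =
    let y , Dy≈v = injective⇒strictlySurjectiveₛ (displacement-injective A fixedFree) (translation g)
    in y , λ i → trans (cong ((A · y) i +_) (sym (Dy≈v i))) (x+[y-x]≡y ((A · y) i) (y i))
    where A = mat (lin g)

  covering : ∀ p w → ¬ w ≈ᵥ 𝟎 → Covers₂ (PointStab p) (LineStab w)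
  covering p w w≉0 g with any?ₛ nonzeroFixed-resp (λ z → ¬? (z ≈ᵥ? 𝟎) ×-dec ((A · z) ≈ᵥ? z))
    where
    A = mat (lin g)
    nonzeroFixed-resp : ∀ {x y} → x ≈ᵥ y → ¬ x ≈ᵥ 𝟎 × (A · x) ≈ᵥ x → ¬ y ≈ᵥ 𝟎 × (A · y) ≈ᵥ y
    nonzeroFixed-resp x≈y (x≉0 , Ax≈x) =
      (λ y≈0 → x≉0 (V.trans x≈y y≈0)) , V.trans (·-cong A (V.sym x≈y)) (V.trans Ax≈x x≈y)
  ... | yes (z , z≉0 , Az≈z) = inj₂ (fixedVector⇒conjugate _≟ᶠ_ w g w≉0 z≉0 Az≈z)
  ... | no ∄z = inj₁ (fixedPoint⇒conjugate p g (proj₂ (fixedFree⇒fixedPoint g fixedFree)))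
    where
    fixedFree : ∀ z → (mat (lin g) · z) ≈ᵥ z → z ≈ᵥ 𝟎
    fixedFree z Az≈z = decidable-stable (z ≈ᵥ? 𝟎) λ z≉0 → ∄z (z , z≉0 , Az≈z)

distinctIndex : ∀ {n} → 2 ≤ n → (i : Fin n) → ∃ λ j → j ≢ i
distinctIndex (s≤s (s≤s _)) zero    = suc zero , λ ()
distinctIndex (s≤s (s≤s _)) (suc i) = zero , λ ()

mainTheorem2 : ∀ {c : Level} (q : ℕ) → IsPrimePower q →
    (F : Field c) → HasOrder F q →
    (n : ℕ) → 2 ≤ n →
    (p : Affine.Vec F n) →
    (w : Affine.Vec F n) → ¬ (Affine._≈ᵥ_ F n w (Affine.𝟎 F n)) →
    Affine.IsProperSubgroup F n (Affine.PointStab F n p)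
      × Affine.IsProperSubgroup F n (Affine.LineStab F n w)
      × Affine.Covers₂ F n (Affine.PointStab F n p) (Affine.LineStab F n w)
mainTheorem2 q _ F finite n 2≤n p w w≉0 =
  (pointStab-isSubgroup p , pointStab-proper p (fromℕ< 2≤n)) ,
  (lineStab-isSubgroup w w≉0 , lineStab-proper _≟ᶠ_ w w≉0 (distinctIndex 2≤n)) ,
  covering p w w≉0
  where
  open AffineGroup F n
  open FiniteAffineGroup F finite n
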